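{- For every integer $n$, $$h_{n-2}h_{n-1}h_{n+1}h_{n+2}-h_n^4=Ed^2q^{n-2}\left[\left(p^2+q\right)h_n^2+Ed^2p^2q^{n-1}\right].$$
   Context: Let $a,b,p,q$ be complex numbers with $q\neq 0$; $d^2=p^2-4q$ and $E=b^2-abp+a^2q$. The Horadam-Lucas sequence $(h_n)_{n\in\mathbb{Z}}$ is defined by $h_0=2b-ap$, $h_1=bp-2aq$, and $h_n=ph_{n-1}-qh_{n-2}$ for all integers $n$ (for negative indices, via $h_{n-2}=(ph_{n-1}-h_n)/q$). -}

module Defs where

open import Level using (Level)
open import Algebra.Bundles using (CommutativeRing)
open import Data.Nat using (ℕ; zero; suc)
open import Data.Integer using (ℤ; +_; -[1+_])

-- Horadam-Lucas sequence over a commutative ring R, for parameters a b p q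
-- together with a chosen inverse qinv of q (this plays the role of q ≠ 0,
-- needed to extend the recurrence to negative indices).
module Horadam {c ℓ : Level} (R : CommutativeRing c ℓ)
  (a b p q qinv : CommutativeRing.Carrier R) where
  open CommutativeRing R hiding (zero)

  pow : Carrier → ℕ → Carrier
  pow x zero = 1#
  pow x (suc n) = x * pow x n

  qpow : ℤ → Carrier
  qpow (+ n) = pow q n
  qpow -[1+ k ] = pow qinv (suc k)

  two four : Carrier
  two = 1# + 1#
  four = two + two

  h0 h1 : Carrier
  h0 = two * b - a * p
  h1 = b * p - two * a * q

  -- d² = p² - 4q  (only d² occurs in the statement)
  d² : Carrier
  d² = p * p - four * q

  E : Carrier
  E = b * b - a * b * p + a * a * q

  hf : ℕ → Carrier
  hf zero = h0
  hf (suc zero) = h1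
  hf (suc (suc n)) = p * hf (suc n) - q * hf n

  -- backward part: hb k = h_{-(k+1)}, via h_{n-2} = (p h_{n-1} - h_n)/q
  hb : ℕ → Carrier
  hb zero = qinv * (p * h0 - h1)
  hb (suc zero) = qinv * (p * hb zero - h0)
  hb (suc (suc k)) = qinv * (p * hb (suc k) - hb k)

  h : ℤ → Carrier
  h (+ n) = hf n
  h -[1+ k ] = hb k

-- With x = h (n-2) and y = h (n-1), the recurrence writes h n, h (n+1), h (n+2) as
-- polynomials in x and y, and the Cassini quantity K(m) = h m h (m+2) - h (m+1)²
-- is multiplied by q at each step, so K(n-2) = E d² q^(n-2) by comparison at m = 0.
-- Then h (n-1) h (n+1) = h n² + q K and h (n-2) h (n+2) = h n² + p² K, and the
-- theorem is the product of these two relations, a polynomial identity in x, y, p, q.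
module Submission where

open import Level using (Level)
open import Algebra.Bundles using (CommutativeRing)
open import Algebra.Solver.Ring.AlmostCommutativeRing
  using (fromCommutativeRing; _-Raw-AlmostCommutative⟶_)
open import Data.Nat as ℕ using (zero; suc)
import Data.Nat.Properties as ℕP
open import Data.Integer as ℤ using (ℤ; +_; -[1+_]; _⊖_)
import Data.Integer.Properties as ℤP
open import Data.Integer using () renaming (_+_ to _+ℤ_; _-_ to _-ℤ_)
open import Data.Maybe using (Maybe; just; nothing)
open import Relation.Binary.PropositionalEquality as ≡ using (_≡_)
open import Relation.Nullary using (yes; no)
open import Defs

module IntegerCoefficients {c ℓ : Level} (R : CommutativeRing c ℓ) where
  open CommutativeRing R hiding (zero)
  open import Algebra.Properties.Ring ring
  open import Algebra.Properties.Semiring.Mult.TCOptimised semiring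
  open import Algebra.Properties.CommutativeSemigroup +-commutativeSemigroup
    using (interchange)
  open import Relation.Binary.Reasoning.Setoid setoid

  fromℤ : ℤ → Carrier
  fromℤ (+ n) = n × 1#
  fromℤ -[1+ n ] = - (suc n × 1#)

  fromℤ-⊖ : ∀ m n → fromℤ (m ⊖ n) ≈ m × 1# - n × 1#
  fromℤ-⊖ zero zero = sym (-‿inverseʳ 0#)
  fromℤ-⊖ zero (suc n) = sym (+-identityˡ _)
  fromℤ-⊖ (suc m) zero = sym (trans (+-congˡ -0#≈0#) (+-identityʳ _))
  fromℤ-⊖ (suc m) (suc n) = begin
    fromℤ (suc m ⊖ suc n)     ≡⟨ ≡.cong fromℤ (ℤP.[1+m]⊖[1+n]≡m⊖n m n) ⟩
    fromℤ (m ⊖ n)             ≈⟨ fromℤ-⊖ m n ⟩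
    M - N                     ≈⟨ +-identityˡ _ ⟨
    0# + (M - N)              ≈⟨ +-congʳ (-‿inverseʳ 1#) ⟨
    (1# - 1#) + (M - N)       ≈⟨ interchange 1# (- 1#) M (- N) ⟩
    (1# + M) + (- 1# + - N)   ≈⟨ +-cong (sym (1+× m 1#)) (trans (-‿+-comm 1# N) (-‿cong (sym (1+× n 1#)))) ⟩
    suc m × 1# - suc n × 1#   ∎
    where
    M = m × 1#
    N = n × 1#

  fromℤ-neg : ∀ i → fromℤ (ℤ.- i) ≈ - fromℤ i
  fromℤ-neg (+ zero) = sym -0#≈0#
  fromℤ-neg (+ suc n) = refl
  fromℤ-neg -[1+ n ] = sym (-‿involutive _)

  fromℤ-+ : ∀ i j → fromℤ (i +ℤ j) ≈ fromℤ i + fromℤ j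
  fromℤ-+ (+ m) (+ n) = ×-homo-+ 1# m n
  fromℤ-+ (+ m) -[1+ n ] = fromℤ-⊖ m (suc n)
  fromℤ-+ -[1+ m ] (+ n) = trans (fromℤ-⊖ n (suc m)) (+-comm _ _)
  fromℤ-+ -[1+ m ] -[1+ n ] = begin
    - (suc (suc (m ℕ.+ n)) × 1#)   ≡⟨ ≡.cong (λ k → - (k × 1#)) (ℕP.+-suc (suc m) n) ⟨
    - ((suc m ℕ.+ suc n) × 1#)     ≈⟨ -‿cong (×-homo-+ 1# (suc m) (suc n)) ⟩
    - (suc m × 1# + suc n × 1#)           ≈⟨ -‿+-comm _ _ ⟨
    - (suc m × 1#) + - (suc n × 1#)       ∎

  fromℤ-*-pos : ∀ m n → fromℤ (+ m ℤ.* + n) ≈ fromℤ (+ m) * fromℤ (+ n)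
  fromℤ-*-pos m n = trans (reflexive (≡.cong fromℤ (≡.sym (ℤP.pos-* m n)))) (×1-homo-* m n)

  fromℤ-*-negˡ : ∀ i j → fromℤ (i ℤ.* j) ≈ fromℤ i * fromℤ j →
                 fromℤ (ℤ.- i ℤ.* j) ≈ fromℤ (ℤ.- i) * fromℤ j
  fromℤ-*-negˡ i j homo = begin
    fromℤ (ℤ.- i ℤ.* j)       ≡⟨ ≡.cong fromℤ (ℤP.neg-distribˡ-* i j) ⟨
    fromℤ (ℤ.- (i ℤ.* j))     ≈⟨ fromℤ-neg (i ℤ.* j) ⟩
    - fromℤ (i ℤ.* j)         ≈⟨ -‿cong homo ⟩
    - (fromℤ i * fromℤ j)     ≈⟨ -‿distribˡ-* _ _ ⟩
    - fromℤ i * fromℤ j       ≈⟨ *-congʳ (fromℤ-neg i) ⟨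
    fromℤ (ℤ.- i) * fromℤ j   ∎

  fromℤ-*-negʳ : ∀ i j → fromℤ (i ℤ.* j) ≈ fromℤ i * fromℤ j →
                 fromℤ (i ℤ.* ℤ.- j) ≈ fromℤ i * fromℤ (ℤ.- j)
  fromℤ-*-negʳ i j homo = begin
    fromℤ (i ℤ.* ℤ.- j)       ≡⟨ ≡.cong fromℤ (ℤP.neg-distribʳ-* i j) ⟨
    fromℤ (ℤ.- (i ℤ.* j))     ≈⟨ fromℤ-neg (i ℤ.* j) ⟩
    - fromℤ (i ℤ.* j)         ≈⟨ -‿cong homo ⟩
    - (fromℤ i * fromℤ j)     ≈⟨ -‿distribʳ-* _ _ ⟩
    fromℤ i * - fromℤ j       ≈⟨ *-congˡ (fromℤ-neg j) ⟨
    fromℤ i * fromℤ (ℤ.- j)   ∎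

  fromℤ-* : ∀ i j → fromℤ (i ℤ.* j) ≈ fromℤ i * fromℤ j
  fromℤ-* (+ m) (+ n) = fromℤ-*-pos m n
  fromℤ-* (+ m) -[1+ n ] = fromℤ-*-negʳ (+ m) (+ suc n) (fromℤ-*-pos m (suc n))
  fromℤ-* -[1+ m ] (+ n) = fromℤ-*-negˡ (+ suc m) (+ n) (fromℤ-*-pos (suc m) n)
  fromℤ-* -[1+ m ] -[1+ n ] =
    fromℤ-*-negˡ (+ suc m) -[1+ n ]
      (fromℤ-*-negʳ (+ suc m) (+ suc n) (fromℤ-*-pos (suc m) (suc n)))

  fromℤ-homomorphism : ℤ.+-*-rawRing -Raw-AlmostCommutative⟶ fromCommutativeRing R
  fromℤ-homomorphism = record
    { ⟦_⟧ = fromℤ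
    ; +-homo = fromℤ-+
    ; *-homo = fromℤ-*
    ; -‿homo = fromℤ-neg
    ; 0-homo = refl
    ; 1-homo = refl
    }

  fromℤ-≟ : ∀ i j → Maybe (fromℤ i ≈ fromℤ j)
  fromℤ-≟ i j with i ℤ.≟ j
  ... | yes ≡.refl = just refl
  ... | no _ = nothing

  open import Algebra.Solver.Ring ℤ.+-*-rawRing (fromCommutativeRing R) fromℤ-homomorphism fromℤ-≟
    public

module HoradamProperties {c ℓ : Level} (R : CommutativeRing c ℓ)
  (a b p q qinv : CommutativeRing.Carrier R)
  (q*qinv≈1 : CommutativeRing._≈_ R (CommutativeRing._*_ R q qinv) (CommutativeRing.1# R))
  where
  open CommutativeRing R hiding (zero)
  open Horadam R a b p q qinv
  open IntegerCoefficients R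
  open import Algebra.Properties.Semiring.Exp semiring using (^-congˡ)
  open import Algebra.Properties.CommutativeSemigroup *-commutativeSemigroup using (x∙yz≈y∙xz; x∙yz≈yx∙z)
  open import Relation.Binary.Reasoning.Setoid setoid

  q*[qinv*x]≈x : ∀ x → q * (qinv * x) ≈ x
  q*[qinv*x]≈x x = trans (sym (*-assoc q qinv x)) (trans (*-congʳ q*qinv≈1) (*-identityˡ x))

  qinv*[q*x]≈x : ∀ x → qinv * (q * x) ≈ x
  qinv*[q*x]≈x x = trans (sym (*-assoc qinv q x)) (trans (*-congʳ (trans (*-comm qinv q) q*qinv≈1)) (*-identityˡ x))

  next : Carrier → Carrier → Carrier
  next x y = p * y - q * x

  next-cong : ∀ {x x′ y y′} → x ≈ x′ → y ≈ y′ → next x y ≈ next x′ y′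
  next-cong x≈x′ y≈y′ = +-cong (*-congˡ y≈y′) (-‿cong (*-congˡ x≈x′))

  next-backward : ∀ x y → next (qinv * (p * y - x)) y ≈ x
  next-backward x y = trans (+-congˡ (-‿cong (q*[qinv*x]≈x _)))
    (solve 3 (λ p y x → p :* y :- (p :* y :- x) := x) refl p y x)

  h-rec : ∀ m → h (m +ℤ + 1 +ℤ + 1) ≈ next (h m) (h (m +ℤ + 1))
  h-rec (+ k) rewrite ℕP.+-comm k 1 | ℕP.+-comm (suc k) 1 = refl
  h-rec -[1+ 0 ] = sym (next-backward h1 h0)
  h-rec -[1+ 1 ] = sym (next-backward h0 (hb 0))
  h-rec -[1+ suc (suc k) ] = sym (next-backward (hb k) (hb (suc k)))

  qpow-suc : ∀ m → qpow (m +ℤ + 1) ≈ q * qpow m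
  qpow-suc (+ k) rewrite ℕP.+-comm k 1 = refl
  qpow-suc -[1+ 0 ] = sym (q*[qinv*x]≈x 1#)
  qpow-suc -[1+ suc k ] = sym (q*[qinv*x]≈x (pow qinv (suc k)))

  Geometric : (ℤ → Carrier) → Set ℓ
  Geometric f = ∀ m → f (m +ℤ + 1) ≈ q * f m

  geometric-unique : ∀ {f g} → Geometric f → Geometric g → f (+ 0) ≈ g (+ 0) → ∀ m → f m ≈ g m
  geometric-unique {f} {g} f-geo g-geo f₀≈g₀ = go
    where
    forward : ∀ m → f m ≈ g m → f (m +ℤ + 1) ≈ g (m +ℤ + 1)
    forward m fm≈gm = trans (f-geo m) (trans (*-congˡ fm≈gm) (sym (g-geo m)))

    backward : ∀ m → f (m +ℤ + 1) ≈ g (m +ℤ + 1) → f m ≈ g m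
    backward m fm₊≈gm₊ = begin
      f m                   ≈⟨ qinv*[q*x]≈x (f m) ⟨
      qinv * (q * f m)      ≈⟨ *-congˡ (f-geo m) ⟨
      qinv * f (m +ℤ + 1)   ≈⟨ *-congˡ fm₊≈gm₊ ⟩
      qinv * g (m +ℤ + 1)   ≈⟨ *-congˡ (g-geo m) ⟩
      qinv * (q * g m)      ≈⟨ qinv*[q*x]≈x (g m) ⟩
      g m                   ∎

    go : ∀ m → f m ≈ g m
    go (+ zero) = f₀≈g₀
    go (+ suc k) = ≡.subst (λ m → f m ≈ g m) (≡.cong +_ (ℕP.+-comm k 1)) (forward (+ k) (go (+ k)))
    go -[1+ zero ] = backward -[1+ zero ] f₀≈g₀
    go -[1+ suc k ] = backward -[1+ suc k ] (go -[1+ k ])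

  cassini : Carrier → Carrier → Carrier
  cassini x y = x * next x y - y * y

  cassini-congʳ : ∀ {x y y′} → y ≈ y′ → cassini x y ≈ cassini x y′
  cassini-congʳ y≈y′ = +-cong (*-congˡ (next-cong refl y≈y′)) (-‿cong (*-cong y≈y′ y≈y′))

  cassini-next : ∀ x y → cassini y (next x y) ≈ q * cassini x y
  cassini-next x y = solve 4 (λ x y p q →
      let u = p :* y :- q :* x
      in y :* (p :* u :- q :* y) :- u :* u := q :* (x :* u :- y :* y))
    refl x y p q

  cassini-h₀h₁ : cassini h0 h1 ≈ E * d²
  cassini-h₀h₁ = solve 4 (λ a b p q →
      let two = con (+ 2)
          h₀ = two :* b :- a :* p
          h₁ = b :* p :- two :* a :* q
      in h₀ :* (p :* h₁ :- q :* h₀) :- h₁ :* h₁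
           := (b :* b :- a :* b :* p :+ a :* a :* q) :* (p :* p :- (two :+ two) :* q))
    refl a b p q

  h-cassini : ∀ m → cassini (h m) (h (m +ℤ + 1)) ≈ E * d² * qpow m
  h-cassini = geometric-unique cassini-geometric Ed²qpow-geometric (trans cassini-h₀h₁ (sym (*-identityʳ _)))
    where
    cassini-geometric : Geometric (λ m → cassini (h m) (h (m +ℤ + 1)))
    cassini-geometric m = trans (cassini-congʳ (h-rec m)) (cassini-next (h m) (h (m +ℤ + 1)))

    Ed²qpow-geometric : Geometric (λ m → E * d² * qpow m)
    Ed²qpow-geometric m = trans (*-congˡ (qpow-suc m)) (x∙yz≈y∙xz (E * d²) q (qpow m))

  five-term-identity : ∀ x y →
    let u = next x y
        v = next y u
        w = next u v
        K = cassini x y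
    in x * y * v * w - pow u 4 ≈ K * ((p * p + q) * (u * u) + p * p * (q * K))
  five-term-identity x y = solve 4 (λ x y p q →
      let u = p :* y :- q :* x
          v = p :* u :- q :* y
          w = p :* v :- q :* u
          K = x :* u :- y :* y
      in x :* y :* v :* w :- u :^ 4 := K :* ((p :* p :+ q) :* (u :* u) :+ p :* p :* (q :* K)))
    refl x y p q

  -- The consecutive indices are linked by equations because, for a variable n,
  -- n -ℤ + 2 +ℤ + 1 and n -ℤ + 1 are only propositionally equal.
  h-five-term : ∀ {m₀ m₁ m₂ m₃ m₄} →
    m₀ +ℤ + 1 ≡ m₁ → m₁ +ℤ + 1 ≡ m₂ → m₂ +ℤ + 1 ≡ m₃ → m₃ +ℤ + 1 ≡ m₄ →
    h m₀ * h m₁ * h m₃ * h m₄ - pow (h m₂) 4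
      ≈ E * d² * qpow m₀ * ((p * p + q) * (h m₂ * h m₂) + E * d² * (p * p) * qpow m₁)
  h-five-term {m} ≡.refl ≡.refl ≡.refl ≡.refl = begin
    x * y * h m₃ * h m₄ - pow (h m₂) 4
      ≈⟨ +-congʳ (*-cong (*-congˡ h₃≈v) h₄≈w) ⟩
    x * y * v * w - pow (h m₂) 4
      ≈⟨ +-congˡ (-‿cong (^-congˡ 4 h₂≈u)) ⟩
    x * y * v * w - pow u 4
      ≈⟨ five-term-identity x y ⟩
    K * ((p * p + q) * (u * u) + p * p * (q * K))
      ≈⟨ *-cong Ed²qᵐ≈K (+-cong (*-congˡ (*-cong h₂≈u h₂≈u)) (*-congˡ Ed²qᵐ⁺¹≈qK)) ⟨
    E * d² * qpow m * ((p * p + q) * (h m₂ * h m₂) + p * p * (E * d² * qpow m₁))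
      ≈⟨ *-congˡ (+-congˡ (x∙yz≈yx∙z (p * p) (E * d²) (qpow m₁))) ⟩
    E * d² * qpow m * ((p * p + q) * (h m₂ * h m₂) + E * d² * (p * p) * qpow m₁) ∎
    where
    m₁ = m +ℤ + 1
    m₂ = m₁ +ℤ + 1
    m₃ = m₂ +ℤ + 1
    m₄ = m₃ +ℤ + 1
    x = h m
    y = h m₁
    u = next x y
    v = next y u
    w = next u v
    K = cassini x y
    h₂≈u : h m₂ ≈ u
    h₂≈u = h-rec m
    h₃≈v : h m₃ ≈ v
    h₃≈v = trans (h-rec m₁) (next-cong refl h₂≈u)
    h₄≈w : h m₄ ≈ w
    h₄≈w = trans (h-rec m₂) (next-cong h₂≈u h₃≈v)
    Ed²qᵐ≈K : E * d² * qpow m ≈ K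
    Ed²qᵐ≈K = sym (h-cassini m)
    Ed²qᵐ⁺¹≈qK : E * d² * qpow m₁ ≈ q * K
    Ed²qᵐ⁺¹≈qK = trans (*-congˡ (qpow-suc m)) (trans (x∙yz≈y∙xz (E * d²) q (qpow m)) (*-congˡ Ed²qᵐ≈K))

mainTheorem9 : {c ℓ : Level} (R : CommutativeRing c ℓ) →
    let open CommutativeRing R in
    (a b p q qinv : Carrier) → q * qinv ≈ 1# →
    let open Horadam R a b p q qinv in
    (n : ℤ) →
    h (n -ℤ + 2) * h (n -ℤ + 1) * h (n +ℤ + 1) * h (n +ℤ + 2) - pow (h n) 4
      ≈ E * d² * qpow (n -ℤ + 2)
          * ((p * p + q) * (h n * h n) + E * d² * (p * p) * qpow (n -ℤ + 1))
mainTheorem9 R a b p q qinv q*qinv≈1 n =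
  HoradamProperties.h-five-term R a b p q qinv q*qinv≈1 {n -ℤ + 2}
    (ℤP.+-assoc n (ℤ.- + 2) (+ 1))
    (≡.trans (ℤP.+-assoc n (ℤ.- + 1) (+ 1)) (ℤP.+-identityʳ n))
    ≡.refl
    (ℤP.+-assoc n (+ 1) (+ 1))
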